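{- Let $t_0(u)=u^2-2$ and $t_i(u)=t_{i-1}(u)^2-2$ for $i\ge1$, and set $T_i(u)=t_i(u)-u$ for $i\ge0$. Let $V(x)=x^5-x^4-4x^3+3x^2+3x-1$ with roots $x_1,\dots,x_5$, and for $i\ge0$ let $T_i(V)$ denote the monic polynomial $\prod_{j=1}^5\bigl(x-T_i(x_j)\bigr)$. Let $G(x)=x^5+2x^4-5x^3-2x^2+4x-1$, $A(x)=x^5+2x^4-5x^3-13x^2-7x-1$, $B(x)=x^5+2x^4-16x^3-24x^2+48x+32$. Then for every $k\ge0$: $T_{5k}(V)=A$, $T_{5k+1}(V)=G$, $T_{5k+2}(V)=G$, $T_{5k+3}(V)=A$, $T_{5k+4}(V)=B$. Moreover the discriminant of $A$ is $11^4$ and the discriminant of $B$ is $11^4\cdot2^{20}$. -}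

module Defs where

open import Level using (_⊔_)
open import Data.Nat as ℕ using (ℕ; zero; suc)
open import Data.Integer as ℤ using (ℤ; +_; -[1+_])
open import Data.Fin using (Fin)
open import Data.List using (allFin; List; []; _∷_; map; reverse; replicate; _++_; length; upTo; foldr)
open import Data.List.Relation.Binary.Pointwise using (Pointwise)
open import Algebra.Bundles using (CommutativeRing)

-- Integer polynomials, as lists of coefficients in ASCENDING order
-- (index i = coefficient of x^i).

ℤPoly : Set
ℤPoly = List ℤ

Vpoly : ℤPoly
Vpoly = ℤ.- (+ 1) ∷ + 3 ∷ + 3 ∷ ℤ.- (+ 4) ∷ ℤ.- (+ 1) ∷ + 1 ∷ []

Gpoly : ℤPoly
Gpoly = ℤ.- (+ 1) ∷ + 4 ∷ ℤ.- (+ 2) ∷ ℤ.- (+ 5) ∷ + 2 ∷ + 1 ∷ []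

Apoly : ℤPoly
Apoly = ℤ.- (+ 1) ∷ ℤ.- (+ 7) ∷ ℤ.- (+ 13) ∷ ℤ.- (+ 5) ∷ + 2 ∷ + 1 ∷ []

Bpoly : ℤPoly
Bpoly = + 32 ∷ + 48 ∷ ℤ.- (+ 24) ∷ ℤ.- (+ 16) ∷ + 2 ∷ + 1 ∷ []

derivAux : ℕ → ℤPoly → ℤPoly
derivAux k []       = []
derivAux k (a ∷ as) = (+ k) ℤ.* a ∷ derivAux (suc k) as

deriv : ℤPoly → ℤPoly
deriv []       = []
deriv (_ ∷ as) = derivAux 1 as

-- degree of a polynomial given by a list whose last entry is the
-- (nonzero) leading coefficient
deg : ℤPoly → ℕ
deg p = length p ℕ.∸ 1

removeAt : {A : Set} → ℕ → List A → List A
removeAt j       []       = []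
removeAt zero    (x ∷ xs) = xs
removeAt (suc j) (x ∷ xs) = x ∷ removeAt j xs

-- determinant of a square matrix given as a list of rows,
-- by Laplace expansion along the first row.  detN is structurally
-- recursive on its first argument (the number of rows); det uses
-- the actual number of rows, so detN is always called with the size.
detN : ℕ → List (List ℤ) → ℤ
detN _       []       = + 1
detN zero    (_ ∷ _)  = + 1   -- unreachable from det
detN (suc n) (r ∷ rs) = go 0 r
  where
  sgn : ℕ → ℤ → ℤ
  sgn zero    z = z
  sgn (suc j) z = ℤ.- sgn j z
  go : ℕ → List ℤ → ℤ
  go j []       = + 0
  go j (a ∷ as) = sgn j (a ℤ.* detN n (map (removeAt j) rs)) ℤ.+ go (suc j) as

det : List (List ℤ) → ℤ
det m = detN (length m) m

-- Sylvester matrix of f (degree m) and g (degree n): (m+n)×(m+n),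
-- first n rows are shifts of the coefficients of f (descending order),
-- last m rows are shifts of the coefficients of g.
sylvester : ℤPoly → ℤPoly → List (List ℤ)
sylvester f g =
  map (λ k → replicate k (+ 0) ++ reverse f ++ replicate (n ℕ.∸ suc k) (+ 0)) (upTo n)
  ++ map (λ k → replicate k (+ 0) ++ reverse g ++ replicate (m ℕ.∸ suc k) (+ 0)) (upTo m)
  where
  m = deg f
  n = deg g

resultant : ℤPoly → ℤPoly → ℤ
resultant f g = det (sylvester f g)

negPow : ℕ → ℤ → ℤ
negPow zero          z = z
negPow (suc zero)    z = ℤ.- z
negPow (suc (suc k)) z = negPow k z

-- Discriminant of a MONIC polynomial f of degree n:
--   disc f = (-1)^{n(n-1)/2} · Res(f, f')    (leading coefficient 1).
discMonic : ℤPoly → ℤ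
discMonic f = negPow ((n ℕ.* (n ℕ.∸ 1)) ℕ./ 2) (resultant f (deriv f))
  where n = deg f

module RingPoly {c ℓ} (R : CommutativeRing c ℓ) where
  open CommutativeRing R

  embedℕ : ℕ → Carrier
  embedℕ zero    = 0#
  embedℕ (suc n) = 1# + embedℕ n

  embedℤ : ℤ → Carrier
  embedℤ (+ n)      = embedℕ n
  embedℤ -[1+ n ]   = - embedℕ (suc n)

  t : ℕ → Carrier → Carrier
  t zero    u = u * u - embedℕ 2
  t (suc i) u = t i u * t i u - embedℕ 2

  T : ℕ → Carrier → Carrier
  T i u = t i u - u

  RPoly : Set c
  RPoly = List Carrier

  addP : RPoly → RPoly → RPoly
  addP []       q        = q
  addP (a ∷ p)  []       = a ∷ p
  addP (a ∷ p)  (b ∷ q)  = (a + b) ∷ addP p q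

  mulP : RPoly → RPoly → RPoly
  mulP []      q = []
  mulP (a ∷ p) q = addP (map (a *_) q) (0# ∷ mulP p q)

  lin : Carrier → RPoly
  lin a = (- a) ∷ 1# ∷ []

  prod5 : (Fin 5 → Carrier) → RPoly
  prod5 y = foldr (λ j p → mulP (lin (y j)) p) (1# ∷ []) (allFin 5)

  _≈P_ : RPoly → RPoly → Set (c ⊔ ℓ)
  p ≈P q = Pointwise _≈_ p q

  fromℤPoly : ℤPoly → RPoly
  fromℤPoly = map embedℤ

  TiPoly : ℕ → (Fin 5 → Carrier) → RPoly
  TiPoly i x = prod5 (λ j → T i (x j))

module Submission where

-- Let x₁,…,x₅ be elements of an arbitrary commutative ring R with
-- ∏ⱼ (X - xⱼ) = V.  Every coefficient of ∏ⱼ (X - h(xⱼ)), for an integer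
-- polynomial h, is an integer polynomial in the xⱼ, and it can be reduced to
-- an integer using only the relations expressing ∏ⱼ (X - xⱼ) = V: x₁ is a
-- root of V, x₂ a root of the monic quotient V / (X - x₁) (whose
-- coefficients involve x₁), and so on.  This is computation in the
-- splitting tower ℤ ⊂ ℤ[x₁] ⊂ ℤ[x₁,x₂] ⊂ … of V.
--
-- Separately, in ℤ[x]/(V) the map
-- σ(u) = u² - 2 satisfies σ⁵(x) = -x; since t_i = σ^(i+1) and σ is even, this
-- makes t_i(xⱼ) periodic in i with period 5, and T_r(xⱼ) = h_r(xⱼ) for an
-- integer polynomial h_r.  The theorem follows by evaluating charPoly for
-- h₀,…,h₄, and the two discriminants, by closed computation.

open import Defs
open import Level using (Level; _⊔_)
open import Data.Nat as ℕ using (ℕ; zero; suc)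
open import Data.Nat.Tactic.RingSolver using (solve-∀)
import Data.Nat.Properties as ℕP
open import Data.Integer as ℤ using (ℤ; +_; -[1+_])
import Data.Integer.Properties as ℤP
open import Data.Sign as Sign using (Sign)
open import Data.Bool using (Bool; true; false)
open import Data.Maybe using (Maybe; just; nothing; _>>=_)
open import Data.Fin using (Fin) renaming (zero to fzero; suc to fsuc)
open import Data.Vec as Vec using (Vec; []; _∷_)
open import Data.List using (List; []; _∷_; map)
import Data.List.Relation.Binary.Pointwise as Pw
open Pw using ([]; _∷_)
open import Data.Product using (_×_; _,_; proj₁; proj₂; map₁; ∃; ∃₂)
open import Function using (_∘_)
open import Relation.Binary.PropositionalEquality as ≡ using (_≡_)
open import Algebra.Bundles using (CommutativeRing; Semiring)

-- A concrete representation of a commutative ring: data with integer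
-- constants and ring operations, plus a zero test that is only required to be
-- sound (it is used to skip work and to certify that coefficients vanish).
record CompRing : Set₁ where
  infixl 6 _⊕_
  infixl 7 _⊗_
  infix  8 ⊝_
  field
    Elem    : Set
    const   : ℤ → Elem
    _⊕_ _⊗_ : Elem → Elem → Elem
    ⊝_      : Elem → Elem
    isZero  : Elem → Bool

isZeroℤ : ℤ → Bool
isZeroℤ (+ zero) = true
isZeroℤ _        = false

ℤ-comp : CompRing
ℤ-comp = record
  { Elem = ℤ ; const = λ z → z ; _⊕_ = ℤ._+_ ; _⊗_ = ℤ._*_ ; ⊝_ = ℤ.-_ ; isZero = isZeroℤ }

module CompPoly (𝔸 : CompRing) where
  open CompRing 𝔸

  addC : List Elem → List Elem → List Elem
  addC []      q       = q
  addC (a ∷ p) []      = a ∷ p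
  addC (a ∷ p) (b ∷ q) = a ⊕ b ∷ addC p q

  mulC : List Elem → List Elem → List Elem
  mulC []      q = []
  mulC (a ∷ p) q = addC (map (a ⊗_) q) (const (+ 0) ∷ mulC p q)

  linC : Elem → List Elem
  linC a = ⊝ a ∷ const (+ 1) ∷ []

-- Adjoining a root α of the monic polynomial X^(d+1) + c_d X^d + … + c₀,
-- given by rel = (c₀, …, c_d).  An element is a vector (v₀, …, v_d) standing
-- for Σ vᵢ αⁱ; products are reduced with α^(d+1) = -(c₀ + … + c_d α^d).
module Adjoin (𝔸 : CompRing) {d : ℕ} (rel : Vec (CompRing.Elem 𝔸) (suc d)) where
  open CompRing 𝔸

  Elem′ : Set
  Elem′ = Vec Elem (suc d)

  zeros : ∀ {n} → Vec Elem n
  zeros = Vec.replicate _ (const (+ 0))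

  lift : Elem → Elem′
  lift a = a ∷ zeros

  add : ∀ {n} → Vec Elem n → Vec Elem n → Vec Elem n
  add = Vec.zipWith _⊕_

  neg : ∀ {n} → Vec Elem n → Vec Elem n
  neg = Vec.map ⊝_

  scale : ∀ {n} → Elem → Vec Elem n → Vec Elem n
  scale a = Vec.map (a ⊗_)

  -- shiftIn c v = ((c, v₀, …, v_{n-2}), v_{n-1}): the coefficients of
  -- c + α·v below α^n, and the coefficient of α^n that overflows.
  shiftIn : ∀ {n} → Elem → Vec Elem n → Vec Elem n × Elem
  shiftIn c []      = [] , c
  shiftIn c (a ∷ v) = map₁ (c ∷_) (shiftIn a v)

  reduceTop : Elem′ → Elem → Elem′
  reduceTop w top with isZero top
  ... | true  = w
  ... | false = add w (neg (scale top rel))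

  timesα : Elem′ → Elem′
  timesα v = reduceTop (proj₁ s) (proj₂ s)
    where
    s : Elem′ × Elem
    s = shiftIn (const (+ 0)) v

  mul : ∀ {n} → Vec Elem n → Elem′ → Elem′
  mul []      w = zeros
  mul (a ∷ u) w with isZero a
  ... | true  = timesα (mul u w)
  ... | false = add (scale a w) (timesα (mul u w))

  allZero : ∀ {n} → Vec Elem n → Bool
  allZero []      = true
  allZero (a ∷ v) with isZero a
  ... | true  = allZero v
  ... | false = false

  adjoined : CompRing
  adjoined = record
    { Elem = Elem′ ; const = λ z → lift (const z) ; _⊕_ = add ; _⊗_ = mul ; ⊝_ = neg ; isZero = allZero }

  -- the adjoined root, computed as α·1 so that it is reduced also when d = 0
  α : Elem′
  α = timesα (lift (const (+ 1)))

  hornerα : ∀ {k} → Elem′ → Vec Elem k → Elem′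
  hornerα s []      = s
  hornerα s (c ∷ v) = add (lift c) (mul α (hornerα s v))

  -- Synthetic division: the lower coefficients of the monic quotient
  -- (X^(d+1) + c_d X^d + … + c₀) / (X - α); the coefficient of X^i is the
  -- value at α of X^(d-i) + c_d X^(d-i-1) + … + c_(i+1).
  suffixValues : ∀ {k} → Vec Elem k → Vec Elem′ k
  suffixValues []      = []
  suffixValues (c ∷ v) = hornerα (lift (const (+ 1))) (c ∷ v) ∷ suffixValues v

  quotient : Vec Elem′ d
  quotient = suffixValues (Vec.tail rel)

  lower : List Elem′ → Maybe (List Elem)
  lower []             = just []
  lower ((a ∷ v) ∷ es) with allZero v | lower es
  ... | true  | just as = just (a ∷ as)
  ... | _     | _       = nothing

>>=-just : ∀ {A B : Set} (m : Maybe A) (f : A → Maybe B) {b} →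
           (m >>= f) ≡ just b → ∃ λ a → m ≡ just a × f a ≡ just b
>>=-just (just a) f eq = a , ≡.refl , eq

-- charPoly 𝔸 n rel h computes ∏ⱼ (X - h(xⱼ)) over 𝔸, where x₁,…,x_n are
-- the roots of the monic polynomial with lower coefficients rel: multiply
-- (X - h(α)) into the product for the quotient by (X - α), computed over
-- 𝔸[α], and descend the result to 𝔸.
charPoly : (𝔸 : CompRing) (n : ℕ) → Vec (CompRing.Elem 𝔸) n →
           ∀ {k} → Vec ℤ k → Maybe (List (CompRing.Elem 𝔸))
charPoly 𝔸 zero    []  h = just (CompRing.const 𝔸 (+ 1) ∷ [])
charPoly 𝔸 (suc n) rel h =
  charPoly adjoined n quotient h >>= λ G →
  lower (mulC (linC (hornerα zeros (Vec.map const h))) G)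
  where
  open CompRing 𝔸 using (const)
  open Adjoin 𝔸 rel
  open CompPoly adjoined using (mulC; linC)

module Iterates (𝔸 : CompRing) where
  open CompRing 𝔸

  σ : Elem → Elem
  σ a = a ⊗ a ⊕ const (ℤ.- (+ 2))

  tC : ℕ → Elem → Elem
  tC zero    a = σ a
  tC (suc i) a = σ (tC i a)

Vlow : Vec ℤ 5
Vlow = ℤ.- (+ 1) ∷ + 3 ∷ + 3 ∷ ℤ.- (+ 4) ∷ ℤ.- (+ 1) ∷ []

ℤ[x]/V : CompRing
ℤ[x]/V = Adjoin.adjoined ℤ-comp Vlow

xV : Vec ℤ 5
xV = Adjoin.α ℤ-comp Vlow

Tclass : ℕ → Vec ℤ 5
Tclass r = tC r xV ⊕ ⊝ xV
  where open CompRing ℤ[x]/V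
        open Iterates ℤ[x]/V

σ⁵≡-id : Iterates.tC ℤ[x]/V 4 xV ≡ CompRing.⊝_ ℤ[x]/V xV
σ⁵≡-id = ≡.refl

charPoly-T₀ : charPoly ℤ-comp 5 Vlow (Tclass 0) ≡ just Apoly
charPoly-T₀ = ≡.refl

charPoly-T₁ : charPoly ℤ-comp 5 Vlow (Tclass 1) ≡ just Gpoly
charPoly-T₁ = ≡.refl

charPoly-T₂ : charPoly ℤ-comp 5 Vlow (Tclass 2) ≡ just Gpoly
charPoly-T₂ = ≡.refl

charPoly-T₃ : charPoly ℤ-comp 5 Vlow (Tclass 3) ≡ just Apoly
charPoly-T₃ = ≡.refl

charPoly-T₄ : charPoly ℤ-comp 5 Vlow (Tclass 4) ≡ just Bpoly
charPoly-T₄ = ≡.refl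

disc-A : discMonic Apoly ≡ (+ 11) ℤ.^ 4
disc-A = ≡.refl

disc-B : discMonic Bpoly ≡ (+ 11) ℤ.^ 4 ℤ.* (+ 2) ℤ.^ 20
disc-B = ≡.refl

module OverRing {c ℓ} (R : CommutativeRing c ℓ) where
  open CommutativeRing R
  open RingPoly R
  open import Algebra.Properties.Ring ring
    using (-‿involutive; -0#≈0#; -‿distribˡ-*; -‿distribʳ-*; -‿+-comm; +-inverseʳ-unique; x≈z//y)
  open import Algebra.Definitions.RawSemiring (Semiring.rawSemiring semiring) using (_^_)
  open import Relation.Binary.Reasoning.Setoid setoid

  -- The canonical map ℤ → R (embedℤ of Defs) is a ring homomorphism.  It
  -- evaluates the bottom of every tower, and it makes the ring solver with
  -- integer constants available in R.
  embedℕ-+ : ∀ m n → embedℕ (m ℕ.+ n) ≈ embedℕ m + embedℕ n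
  embedℕ-+ zero    n = sym (+-identityˡ _)
  embedℕ-+ (suc m) n = trans (+-congˡ (embedℕ-+ m n)) (sym (+-assoc _ _ _))

  embedℕ-* : ∀ m n → embedℕ (m ℕ.* n) ≈ embedℕ m * embedℕ n
  embedℕ-* zero    n = sym (zeroˡ _)
  embedℕ-* (suc m) n = begin
    embedℕ (n ℕ.+ m ℕ.* n)               ≈⟨ embedℕ-+ n (m ℕ.* n) ⟩
    embedℕ n + embedℕ (m ℕ.* n)          ≈⟨ +-cong (sym (*-identityˡ _)) (embedℕ-* m n) ⟩
    1# * embedℕ n + embedℕ m * embedℕ n  ≈⟨ distribʳ _ _ _ ⟨
    (1# + embedℕ m) * embedℕ n           ∎

  -- subtraction of naturals, to which addition on ℤ reduces
  embedℤ-⊖ : ∀ m n → embedℤ (m ℤ.⊖ n) ≈ embedℕ m - embedℕ n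
  embedℤ-⊖ m n = x≈z//y _ _ _ (plus m n)
    where
    plus : ∀ m n → embedℤ (m ℤ.⊖ n) + embedℕ n ≈ embedℕ m
    plus m       zero    = +-identityʳ _
    plus zero    (suc n) = -‿inverseˡ _
    plus (suc m) (suc n) = begin
      embedℤ (suc m ℤ.⊖ suc n) + (1# + embedℕ n)  ≡⟨ ≡.cong (λ z → embedℤ z + (1# + embedℕ n)) (ℤP.[1+m]⊖[1+n]≡m⊖n m n) ⟩
      embedℤ (m ℤ.⊖ n) + (1# + embedℕ n)          ≈⟨ +-congˡ (+-comm _ _) ⟩
      embedℤ (m ℤ.⊖ n) + (embedℕ n + 1#)          ≈⟨ +-assoc _ _ _ ⟨
      (embedℤ (m ℤ.⊖ n) + embedℕ n) + 1#          ≈⟨ +-congʳ (plus m n) ⟩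
      embedℕ m + 1#                               ≈⟨ +-comm _ _ ⟩
      1# + embedℕ m                               ∎

  embedℤ-neg : ∀ z → embedℤ (ℤ.- z) ≈ - embedℤ z
  embedℤ-neg -[1+ n ]    = sym (-‿involutive _)
  embedℤ-neg (+ zero)    = sym -0#≈0#
  embedℤ-neg (+ (suc n)) = refl

  embedℤ-+ : ∀ a b → embedℤ (a ℤ.+ b) ≈ embedℤ a + embedℤ b
  embedℤ-+ -[1+ m ] -[1+ n ] = begin
    - (1# + embedℕ (suc (m ℕ.+ n)))      ≡⟨ ≡.cong (λ k → - (1# + embedℕ k)) (≡.sym (ℕP.+-suc m n)) ⟩
    - embedℕ (suc m ℕ.+ suc n)           ≈⟨ -‿cong (embedℕ-+ (suc m) (suc n)) ⟩
    - (embedℕ (suc m) + embedℕ (suc n))  ≈⟨ -‿+-comm _ _ ⟨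
    - embedℕ (suc m) + - embedℕ (suc n)  ∎
  embedℤ-+ -[1+ m ] (+ n)    = trans (embedℤ-⊖ n (suc m)) (+-comm _ _)
  embedℤ-+ (+ m)    -[1+ n ] = embedℤ-⊖ m (suc n)
  embedℤ-+ (+ m)    (+ n)    = embedℕ-+ m n

  -- multiplication on ℤ works on sign and absolute value separately
  signed : Sign → Carrier → Carrier
  signed Sign.+ x = x
  signed Sign.- x = - x

  embedℤ-◃ : ∀ s n → embedℤ (s ℤ.◃ n) ≈ signed s (embedℕ n)
  embedℤ-◃ Sign.- zero    = sym -0#≈0#
  embedℤ-◃ Sign.+ zero    = refl
  embedℤ-◃ Sign.- (suc n) = refl
  embedℤ-◃ Sign.+ (suc n) = refl

  signed-cong : ∀ s {x y} → x ≈ y → signed s x ≈ signed s y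
  signed-cong Sign.+ e = e
  signed-cong Sign.- e = -‿cong e

  signed-* : ∀ s t x y → signed (s Sign.* t) (x * y) ≈ signed s x * signed t y
  signed-* Sign.- Sign.- x y = trans (sym (-‿involutive _)) (trans (-‿cong (-‿distribˡ-* x y)) (-‿distribʳ-* _ _))
  signed-* Sign.- Sign.+ x y = -‿distribˡ-* x y
  signed-* Sign.+ Sign.- x y = -‿distribʳ-* x y
  signed-* Sign.+ Sign.+ x y = refl

  embedℤ-signed : ∀ z → embedℤ z ≈ signed (ℤ.sign z) (embedℕ ℤ.∣ z ∣)
  embedℤ-signed (+ n)    = refl
  embedℤ-signed -[1+ n ] = refl

  embedℤ-* : ∀ a b → embedℤ (a ℤ.* b) ≈ embedℤ a * embedℤ b
  embedℤ-* a b = begin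
    embedℤ (a ℤ.* b)                                    ≈⟨ embedℤ-◃ (sa Sign.* sb) (ℤ.∣ a ∣ ℕ.* ℤ.∣ b ∣) ⟩
    signed (sa Sign.* sb) (embedℕ (ℤ.∣ a ∣ ℕ.* ℤ.∣ b ∣))  ≈⟨ signed-cong (sa Sign.* sb) (embedℕ-* ℤ.∣ a ∣ ℤ.∣ b ∣) ⟩
    signed (sa Sign.* sb) (embedℕ ℤ.∣ a ∣ * embedℕ ℤ.∣ b ∣) ≈⟨ signed-* sa sb _ _ ⟩
    signed sa (embedℕ ℤ.∣ a ∣) * signed sb (embedℕ ℤ.∣ b ∣) ≈⟨ *-cong (embedℤ-signed a) (embedℤ-signed b) ⟨
    embedℤ a * embedℤ b                                 ∎
    where
    sa sb : Sign
    sa = ℤ.sign a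
    sb = ℤ.sign b

  open import Algebra.Solver.Ring.AlmostCommutativeRing using (fromCommutativeRing; _-Raw-AlmostCommutative⟶_)
  open import Relation.Nullary using (yes; no)

  ℤ⟶R : ℤ.+-*-rawRing -Raw-AlmostCommutative⟶ fromCommutativeRing R
  ℤ⟶R = record
    { ⟦_⟧ = embedℤ ; +-homo = embedℤ-+ ; *-homo = embedℤ-* ; -‿homo = embedℤ-neg
    ; 0-homo = refl ; 1-homo = +-identityʳ 1# }

  constants-equal? : ∀ x y → Maybe (embedℤ x ≈ embedℤ y)
  constants-equal? x y with x ℤ.≟ y
  ... | yes p = just (reflexive (≡.cong embedℤ p))
  ... | no _  = nothing

  open import Algebra.Solver.Ring ℤ.+-*-rawRing (fromCommutativeRing R) ℤ⟶R constants-equal?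
    using (solve; _:=_; _:+_; _:*_; :-_; _:-_; con)

  ≈P-refl : ∀ {p} → p ≈P p
  ≈P-refl = Pw.refl refl

  ≈P-sym : ∀ {p q} → p ≈P q → q ≈P p
  ≈P-sym = Pw.symmetric sym

  ≈P-trans : ∀ {p q r} → p ≈P q → q ≈P r → p ≈P r
  ≈P-trans = Pw.transitive trans

  addP-cong : ∀ {p p′ q q′} → p ≈P p′ → q ≈P q′ → addP p q ≈P addP p′ q′
  addP-cong []       eq       = eq
  addP-cong (e ∷ es) []       = e ∷ es
  addP-cong (e ∷ es) (f ∷ fs) = +-cong e f ∷ addP-cong es fs

  scale-cong : ∀ {b b′ p p′} → b ≈ b′ → p ≈P p′ → map (b *_) p ≈P map (b′ *_) p′
  scale-cong e []       = []
  scale-cong e (f ∷ fs) = *-cong e f ∷ scale-cong e fs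

  mulP-cong : ∀ {p p′ q q′} → p ≈P p′ → q ≈P q′ → mulP p q ≈P mulP p′ q′
  mulP-cong []       fq = []
  mulP-cong (e ∷ es) fq = addP-cong (scale-cong e fq) (refl ∷ mulP-cong es fq)

  lin-cong : ∀ {a a′} → a ≈ a′ → lin a ≈P lin a′
  lin-cong e = -‿cong e ∷ refl ∷ []

  evalP : Carrier → RPoly → Carrier
  evalP a []       = 0#
  evalP a (c ∷ cs) = c + a * evalP a cs

  evalP-cong : ∀ a {p q} → p ≈P q → evalP a p ≈ evalP a q
  evalP-cong a []       = refl
  evalP-cong a (e ∷ es) = +-cong e (*-congˡ (evalP-cong a es))

  evalP-addP : ∀ a p q → evalP a (addP p q) ≈ evalP a p + evalP a q
  evalP-addP a []      q       = sym (+-identityˡ _)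
  evalP-addP a (b ∷ p) []      = sym (+-identityʳ _)
  evalP-addP a (b ∷ p) (e ∷ q) = begin
    (b + e) + a * evalP a (addP p q)           ≈⟨ +-congˡ (*-congˡ (evalP-addP a p q)) ⟩
    (b + e) + a * (evalP a p + evalP a q)      ≈⟨ solve 5 (λ b e a x y → (b :+ e) :+ a :* (x :+ y) := (b :+ a :* x) :+ (e :+ a :* y)) refl b e a _ _ ⟩
    (b + a * evalP a p) + (e + a * evalP a q)  ∎

  evalP-scale : ∀ a b q → evalP a (map (b *_) q) ≈ b * evalP a q
  evalP-scale a b []      = sym (zeroʳ _)
  evalP-scale a b (e ∷ q) = begin
    b * e + a * evalP a (map (b *_) q)  ≈⟨ +-congˡ (*-congˡ (evalP-scale a b q)) ⟩
    b * e + a * (b * evalP a q)         ≈⟨ solve 4 (λ b e a y → b :* e :+ a :* (b :* y) := b :* (e :+ a :* y)) refl b e a _ ⟩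
    b * (e + a * evalP a q)             ∎

  evalP-mulP : ∀ a p q → evalP a (mulP p q) ≈ evalP a p * evalP a q
  evalP-mulP a []      q = sym (zeroˡ _)
  evalP-mulP a (b ∷ p) q = begin
    evalP a (addP (map (b *_) q) (0# ∷ mulP p q))        ≈⟨ evalP-addP a (map (b *_) q) (0# ∷ mulP p q) ⟩
    evalP a (map (b *_) q) + (0# + a * evalP a (mulP p q)) ≈⟨ +-cong (evalP-scale a b q) (+-congˡ (*-congˡ (evalP-mulP a p q))) ⟩
    b * evalP a q + (0# + a * (evalP a p * evalP a q))   ≈⟨ solve 4 (λ b y a x → b :* y :+ (con (+ 0) :+ a :* (x :* y)) := (b :+ a :* x) :* y) refl b _ a _ ⟩
    (b + a * evalP a p) * evalP a q                      ∎

  evalP-lin : ∀ a b → evalP a (lin b) ≈ a - b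
  evalP-lin a b = begin
    - b + a * (1# + a * 0#)  ≈⟨ +-congˡ (*-congˡ (trans (+-congˡ (zeroʳ a)) (+-identityʳ 1#))) ⟩
    - b + a * 1#             ≈⟨ +-congˡ (*-identityʳ a) ⟩
    - b + a                  ≈⟨ +-comm _ _ ⟩
    a - b                    ∎

  prodR : ∀ n → (Fin n → Carrier) → RPoly
  prodR zero    x = 1# ∷ []
  prodR (suc n) x = mulP (lin (x fzero)) (prodR n (x ∘ fsuc))

  prodR-cons : ∀ n x → ∃₂ λ q qs → prodR n x ≡ q ∷ qs
  prodR-cons zero    x = _ , _ , ≡.refl
  prodR-cons (suc n) x with prodR n (x ∘ fsuc) | prodR-cons n (x ∘ fsuc)
  ... | _ | q , qs , ≡.refl = _ , _ , ≡.refl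

  prodR-root : ∀ n x (j : Fin n) → evalP (x j) (prodR n x) ≈ 0#
  prodR-root (suc n) x j = trans (evalP-mulP (x j) (lin (x fzero)) (prodR n (x ∘ fsuc))) (vanish j)
    where
    vanish : ∀ j → evalP (x j) (lin (x fzero)) * evalP (x j) (prodR n (x ∘ fsuc)) ≈ 0#
    vanish fzero    = trans (*-congʳ (trans (evalP-lin _ _) (-‿inverseʳ _))) (zeroˡ _)
    vanish (fsuc j) = trans (*-congˡ (prodR-root n (x ∘ fsuc) j)) (zeroʳ _)

  -- Synthetic division by X - a.  suffixEvals a p lists the values at a of the
  -- successive tails c_i + c_{i+1}X + … of p.
  suffixEvals : Carrier → RPoly → RPoly
  suffixEvals a []       = []
  suffixEvals a (c ∷ cs) = evalP a (c ∷ cs) ∷ suffixEvals a cs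

  suffixEvals-cong : ∀ a {p q} → p ≈P q → suffixEvals a p ≈P suffixEvals a q
  suffixEvals-cong a []       = []
  suffixEvals-cong a (e ∷ es) = evalP-cong a (e ∷ es) ∷ suffixEvals-cong a es

  -- the coefficients of X, X², … in (X - a)(q₀ + q₁X + … + q_mX^m)
  upperCoeffs : Carrier → Carrier → RPoly → RPoly
  upperCoeffs a q₀ []       = q₀ ∷ []
  upperCoeffs a q₀ (q ∷ qs) = q₀ - a * q ∷ upperCoeffs a q qs

  -- [] is a right unit of addP (definitionally it is only a left unit)
  addP-identityʳ : ∀ p → addP p [] ≡ p
  addP-identityʳ []      = ≡.refl
  addP-identityʳ (a ∷ p) = ≡.refl

  mulP-lin : ∀ a q₀ qs → mulP (lin a) (q₀ ∷ qs) ≈P ((- a * q₀ + 0#) ∷ upperCoeffs a q₀ qs)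
  mulP-lin a q₀ qs rewrite addP-identityʳ (map (1# *_) qs) =
    refl ∷ upper (trans (+-identityʳ _) (*-identityˡ q₀)) qs
    where
    upper : ∀ {u q₀} → u ≈ q₀ → ∀ qs → addP (map (- a *_) qs) (u ∷ map (1# *_) qs) ≈P upperCoeffs a q₀ qs
    upper e []       = e ∷ []
    upper e (q ∷ qs) = trans (+-comm _ _) (+-cong e (sym (-‿distribˡ-* a q))) ∷ upper (*-identityˡ q) qs

  evalP-upper : ∀ a q₀ qs → evalP a (upperCoeffs a q₀ qs) ≈ q₀
  evalP-upper a q₀ []       = solve 2 (λ q a → q :+ a :* con (+ 0) := q) refl q₀ a
  evalP-upper a q₀ (q ∷ qs) = begin
    (q₀ - a * q) + a * evalP a (upperCoeffs a q qs)  ≈⟨ +-congˡ (*-congˡ (evalP-upper a q qs)) ⟩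
    (q₀ - a * q) + a * q                             ≈⟨ solve 3 (λ p a q → (p :- a :* q) :+ a :* q := p) refl q₀ a q ⟩
    q₀                                               ∎

  suffixEvals-upper : ∀ a q₀ qs → suffixEvals a (upperCoeffs a q₀ qs) ≈P (q₀ ∷ qs)
  suffixEvals-upper a q₀ []       = evalP-upper a q₀ [] ∷ []
  suffixEvals-upper a q₀ (q ∷ qs) = evalP-upper a q₀ (q ∷ qs) ∷ suffixEvals-upper a q qs

  synthDiv : ∀ a {q q₀ qs p₀ ps} → q ≡ q₀ ∷ qs → mulP (lin a) q ≈P (p₀ ∷ ps) → q ≈P suffixEvals a ps
  synthDiv a {q₀ = q₀} {qs} ≡.refl eq =
    ≈P-trans (≈P-sym (suffixEvals-upper a q₀ qs))
             (suffixEvals-cong a (Pw.tail (≈P-trans (≈P-sym (mulP-lin a q₀ qs)) eq)))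

  record Evaluation (𝔸 : CompRing) : Set (c ⊔ ℓ) where
    open CompRing 𝔸
    field
      ev        : Elem → Carrier
      ev-const  : ∀ z → ev (const z) ≈ embedℤ z
      ev-⊕      : ∀ a b → ev (a ⊕ b) ≈ ev a + ev b
      ev-⊗      : ∀ a b → ev (a ⊗ b) ≈ ev a * ev b
      ev-⊝      : ∀ a → ev (⊝ a) ≈ - ev a
      ev-isZero : ∀ a → isZero a ≡ true → ev a ≈ 0#

  ℤ-evaluation : Evaluation ℤ-comp
  ℤ-evaluation = record
    { ev = embedℤ ; ev-const = λ _ → refl ; ev-⊕ = embedℤ-+ ; ev-⊗ = embedℤ-* ; ev-⊝ = embedℤ-neg
    ; ev-isZero = isZero-sound }
    where
    isZero-sound : ∀ z → isZeroℤ z ≡ true → embedℤ z ≈ 0#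
    isZero-sound (+ zero) _ = refl

  module Evaluated {𝔸 : CompRing} (E : Evaluation 𝔸) where
    open CompRing 𝔸
    open Evaluation E
    open CompPoly 𝔸

    evalFrom : ∀ {k} → Carrier → Carrier → Vec Elem k → Carrier
    evalFrom a s []      = s
    evalFrom a s (c ∷ v) = ev c + a * evalFrom a s v

    evalAt : ∀ {k} → Carrier → Vec Elem k → Carrier
    evalAt a = evalFrom a 0#

    evalFrom-cong : ∀ {k} a {s s′} → s ≈ s′ → (v : Vec Elem k) → evalFrom a s v ≈ evalFrom a s′ v
    evalFrom-cong a e []      = e
    evalFrom-cong a e (c ∷ v) = +-congˡ (*-congˡ (evalFrom-cong a e v))

    evalFrom-split : ∀ {k} a s (v : Vec Elem k) → evalFrom a s v ≈ evalAt a v + a ^ k * s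
    evalFrom-split a s []      = sym (trans (+-identityˡ _) (*-identityˡ s))
    evalFrom-split {suc k} a s (b ∷ v) = begin
      ev b + a * evalFrom a s v              ≈⟨ +-congˡ (*-congˡ (evalFrom-split a s v)) ⟩
      ev b + a * (evalAt a v + a ^ k * s)    ≈⟨ solve 5 (λ b a y p s → b :+ a :* (y :+ p :* s) := (b :+ a :* y) :+ (a :* p) :* s) refl (ev b) a (evalAt a v) (a ^ k) s ⟩
      (ev b + a * evalAt a v) + a ^ suc k * s  ∎

    monic : ∀ {k} → Vec Elem k → RPoly
    monic []      = 1# ∷ []
    monic (c ∷ v) = ev c ∷ monic v

    evalP-monic : ∀ {k} a (v : Vec Elem k) → evalP a (monic v) ≈ evalFrom a 1# v
    evalP-monic a []      = trans (+-congˡ (zeroʳ a)) (+-identityʳ 1#)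
    evalP-monic a (c ∷ v) = +-congˡ (*-congˡ (evalP-monic a v))

    addC-hom : ∀ p q → map ev (addC p q) ≈P addP (map ev p) (map ev q)
    addC-hom []      q       = ≈P-refl
    addC-hom (a ∷ p) []      = ≈P-refl
    addC-hom (a ∷ p) (b ∷ q) = ev-⊕ a b ∷ addC-hom p q

    scaleC-hom : ∀ a q → map ev (map (a ⊗_) q) ≈P map (ev a *_) (map ev q)
    scaleC-hom a []      = []
    scaleC-hom a (b ∷ q) = ev-⊗ a b ∷ scaleC-hom a q

    mulC-hom : ∀ p q → map ev (mulC p q) ≈P mulP (map ev p) (map ev q)
    mulC-hom []      q = []
    mulC-hom (a ∷ p) q = ≈P-trans (addC-hom (map (a ⊗_) q) (const (+ 0) ∷ mulC p q))
                                  (addP-cong (scaleC-hom a q) (ev-const (+ 0) ∷ mulC-hom p q))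

    linC-hom : ∀ a → map ev (linC a) ≈P lin (ev a)
    linC-hom a = ev-⊝ a ∷ trans (ev-const (+ 1)) (+-identityʳ 1#) ∷ []

    open Iterates 𝔸 using (σ; tC)

    ev-σ : ∀ b → ev (σ b) ≈ ev b * ev b - embedℕ 2
    ev-σ b = trans (ev-⊕ _ _) (+-cong (ev-⊗ b b) (ev-const _))

    ev-tC : ∀ i b → ev (tC i b) ≈ t i (ev b)
    ev-tC zero    b = ev-σ b
    ev-tC (suc i) b = trans (ev-σ (tC i b)) (+-congʳ (*-cong (ev-tC i b) (ev-tC i b)))

  open Evaluated ℤ-evaluation using () renaming (evalAt to evalℤ)

  evalAt-const : ∀ {𝔸} (E : Evaluation 𝔸) a {k} (h : Vec ℤ k) →
                 Evaluated.evalAt E a (Vec.map (CompRing.const 𝔸) h) ≈ evalℤ a h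
  evalAt-const E a []      = refl
  evalAt-const E a (z ∷ h) = +-cong (Evaluation.ev-const E z) (*-congˡ (evalAt-const E a h))

  module AdjoinEval {𝔸 : CompRing} (E : Evaluation 𝔸) {d : ℕ} (rel : Vec (CompRing.Elem 𝔸) (suc d))
                    (a : Carrier) (root : Evaluated.evalFrom E a 1# rel ≈ 0#) where
    open CompRing 𝔸
    open Evaluation E
    open Evaluated E
    open Adjoin 𝔸 rel

    ev′ : Elem′ → Carrier
    ev′ = evalAt a

    ev′-zeros : ∀ n → evalAt a (zeros {n}) ≈ 0#
    ev′-zeros zero    = refl
    ev′-zeros (suc n) = begin
      ev (const (+ 0)) + a * evalAt a (zeros {n})  ≈⟨ +-cong (ev-const (+ 0)) (*-congˡ (ev′-zeros n)) ⟩
      0# + a * 0#                                  ≈⟨ solve 1 (λ a → con (+ 0) :+ a :* con (+ 0) := con (+ 0)) refl a ⟩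
      0#                                           ∎

    ev′-lift : ∀ b → ev′ (lift b) ≈ ev b
    ev′-lift b = trans (+-congˡ (trans (*-congˡ (ev′-zeros d)) (zeroʳ a))) (+-identityʳ _)

    ev′-add : ∀ {n} (u v : Vec Elem n) → evalAt a (add u v) ≈ evalAt a u + evalAt a v
    ev′-add []      []      = sym (+-identityʳ 0#)
    ev′-add (b ∷ u) (e ∷ v) = begin
      ev (b ⊕ e) + a * evalAt a (add u v)            ≈⟨ +-cong (ev-⊕ b e) (*-congˡ (ev′-add u v)) ⟩
      (ev b + ev e) + a * (evalAt a u + evalAt a v)  ≈⟨ solve 5 (λ x y a p q → (x :+ y) :+ a :* (p :+ q) := (x :+ a :* p) :+ (y :+ a :* q)) refl (ev b) (ev e) a _ _ ⟩
      (ev b + a * evalAt a u) + (ev e + a * evalAt a v) ∎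

    ev′-scale : ∀ {n} b (v : Vec Elem n) → evalAt a (scale b v) ≈ ev b * evalAt a v
    ev′-scale b []      = sym (zeroʳ _)
    ev′-scale b (e ∷ v) = begin
      ev (b ⊗ e) + a * evalAt a (scale b v)    ≈⟨ +-cong (ev-⊗ b e) (*-congˡ (ev′-scale b v)) ⟩
      ev b * ev e + a * (ev b * evalAt a v)    ≈⟨ solve 4 (λ x y a p → x :* y :+ a :* (x :* p) := x :* (y :+ a :* p)) refl (ev b) (ev e) a _ ⟩
      ev b * (ev e + a * evalAt a v)           ∎

    ev′-neg : ∀ {n} (v : Vec Elem n) → evalAt a (neg v) ≈ - evalAt a v
    ev′-neg []      = sym -0#≈0#
    ev′-neg (e ∷ v) = begin
      ev (⊝ e) + a * evalAt a (neg v)  ≈⟨ +-cong (ev-⊝ e) (*-congˡ (ev′-neg v)) ⟩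
      - ev e + a * (- evalAt a v)      ≈⟨ solve 3 (λ y a p → :- y :+ a :* (:- p) := :- (y :+ a :* p)) refl (ev e) a _ ⟩
      - (ev e + a * evalAt a v)        ∎

    ev′-shiftIn : ∀ {n} b (v : Vec Elem n) →
                  evalFrom a (ev (proj₂ (shiftIn b v))) (proj₁ (shiftIn b v)) ≈ ev b + a * evalAt a v
    ev′-shiftIn b []      = sym (trans (+-congˡ (zeroʳ a)) (+-identityʳ _))
    ev′-shiftIn b (e ∷ v) = +-congˡ (*-congˡ (ev′-shiftIn e v))

    power-relation : a ^ suc d ≈ - ev′ rel
    power-relation = +-inverseʳ-unique _ _ (begin
      ev′ rel + a ^ suc d       ≈⟨ +-congˡ (*-identityʳ _) ⟨
      ev′ rel + a ^ suc d * 1#  ≈⟨ evalFrom-split a 1# rel ⟨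
      evalFrom a 1# rel         ≈⟨ root ⟩
      0#                        ∎)

    ev′-reduceTop : ∀ w top → ev′ (reduceTop w top) ≈ evalFrom a (ev top) w
    ev′-reduceTop w top with isZero top in zero?
    ... | true  = sym (begin
      evalFrom a (ev top) w         ≈⟨ evalFrom-split a (ev top) w ⟩
      ev′ w + a ^ suc d * ev top    ≈⟨ +-congˡ (*-congˡ (ev-isZero top zero?)) ⟩
      ev′ w + a ^ suc d * 0#        ≈⟨ +-congˡ (zeroʳ _) ⟩
      ev′ w + 0#                    ≈⟨ +-identityʳ _ ⟩
      ev′ w                         ∎)
    ... | false = begin
      ev′ (add w (neg (scale top rel)))  ≈⟨ trans (ev′-add w (neg (scale top rel))) (+-congˡ (trans (ev′-neg (scale top rel)) (-‿cong (ev′-scale top rel)))) ⟩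
      ev′ w + - (ev top * ev′ rel)       ≈⟨ +-congˡ (-‿distribʳ-* _ _) ⟩
      ev′ w + ev top * - ev′ rel         ≈⟨ +-congˡ (trans (*-congˡ (sym power-relation)) (*-comm _ _)) ⟩
      ev′ w + a ^ suc d * ev top         ≈⟨ evalFrom-split a (ev top) w ⟨
      evalFrom a (ev top) w              ∎

    ev′-timesα : ∀ v → ev′ (timesα v) ≈ a * ev′ v
    ev′-timesα v = begin
      ev′ (timesα v)                        ≈⟨ ev′-reduceTop (proj₁ s) (proj₂ s) ⟩
      evalFrom a (ev (proj₂ s)) (proj₁ s)   ≈⟨ ev′-shiftIn (const (+ 0)) v ⟩
      ev (const (+ 0)) + a * ev′ v          ≈⟨ +-congʳ (ev-const (+ 0)) ⟩
      0# + a * ev′ v                        ≈⟨ +-identityˡ _ ⟩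
      a * ev′ v                             ∎
      where
      s : Elem′ × Elem
      s = shiftIn (const (+ 0)) v

    ev′-mul : ∀ {n} (u : Vec Elem n) w → ev′ (mul u w) ≈ evalAt a u * ev′ w
    ev′-mul []      w = trans (ev′-zeros (suc d)) (sym (zeroˡ _))
    ev′-mul (b ∷ u) w with isZero b in zero?
    ... | true  = begin
      ev′ (timesα (mul u w))          ≈⟨ trans (ev′-timesα (mul u w)) (*-congˡ (ev′-mul u w)) ⟩
      a * (evalAt a u * ev′ w)        ≈⟨ solve 3 (λ a p y → a :* (p :* y) := (con (+ 0) :+ a :* p) :* y) refl a _ _ ⟩
      (0# + a * evalAt a u) * ev′ w   ≈⟨ *-congʳ (+-congʳ (ev-isZero b zero?)) ⟨
      (ev b + a * evalAt a u) * ev′ w ∎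
    ... | false = begin
      ev′ (add (scale b w) (timesα (mul u w)))  ≈⟨ ev′-add (scale b w) _ ⟩
      ev′ (scale b w) + ev′ (timesα (mul u w))  ≈⟨ +-cong (ev′-scale b w) (trans (ev′-timesα (mul u w)) (*-congˡ (ev′-mul u w))) ⟩
      ev b * ev′ w + a * (evalAt a u * ev′ w)   ≈⟨ solve 4 (λ x y a p → x :* y :+ a :* (p :* y) := (x :+ a :* p) :* y) refl (ev b) _ a _ ⟩
      (ev b + a * evalAt a u) * ev′ w           ∎

    ev′-allZero : ∀ {n} (v : Vec Elem n) → allZero v ≡ true → evalAt a v ≈ 0#
    ev′-allZero []      _ = refl
    ev′-allZero (b ∷ v) p with isZero b in zero?
    ... | true = trans (+-cong (ev-isZero b zero?) (*-congˡ (ev′-allZero v p)))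
                       (solve 1 (λ a → con (+ 0) :+ a :* con (+ 0) := con (+ 0)) refl a)

    evaluation : Evaluation adjoined
    evaluation = record
      { ev = ev′ ; ev-const = λ z → trans (ev′-lift (const z)) (ev-const z)
      ; ev-⊕ = ev′-add ; ev-⊗ = ev′-mul ; ev-⊝ = ev′-neg ; ev-isZero = ev′-allZero }

    ev′-α : ev′ α ≈ a
    ev′-α = begin
      ev′ (timesα (lift (const (+ 1))))  ≈⟨ ev′-timesα (lift (const (+ 1))) ⟩
      a * ev′ (lift (const (+ 1)))       ≈⟨ *-congˡ (trans (ev′-lift (const (+ 1))) (trans (ev-const (+ 1)) (+-identityʳ 1#))) ⟩
      a * 1#                             ≈⟨ *-identityʳ a ⟩
      a                                  ∎

    ev′-hornerα : ∀ {k} s (v : Vec Elem k) → ev′ (hornerα s v) ≈ evalFrom a (ev′ s) v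
    ev′-hornerα s []      = refl
    ev′-hornerα s (b ∷ v) = begin
      ev′ (add (lift b) (mul α (hornerα s v)))  ≈⟨ ev′-add (lift b) (mul α (hornerα s v)) ⟩
      ev′ (lift b) + ev′ (mul α (hornerα s v))  ≈⟨ +-cong (ev′-lift b) (trans (ev′-mul α _) (*-cong ev′-α (ev′-hornerα s v))) ⟩
      ev b + a * evalFrom a (ev′ s) v           ∎

    ev′-suffixValues : ∀ {k} (v : Vec Elem k) →
                       suffixEvals a (monic v) ≈P Evaluated.monic evaluation (suffixValues v)
    ev′-suffixValues []      = trans (+-congˡ (zeroʳ a)) (+-identityʳ 1#) ∷ []
    ev′-suffixValues (b ∷ v) = head ∷ ev′-suffixValues v
      where
      head : evalP a (monic (b ∷ v)) ≈ ev′ (hornerα (lift (const (+ 1))) (b ∷ v))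
      head = begin
        evalP a (monic (b ∷ v))                              ≈⟨ evalP-monic a (b ∷ v) ⟩
        evalFrom a 1# (b ∷ v)                                ≈⟨ evalFrom-cong a (trans (ev′-lift (const (+ 1))) (trans (ev-const (+ 1)) (+-identityʳ 1#))) (b ∷ v) ⟨
        evalFrom a (ev′ (lift (const (+ 1)))) (b ∷ v)        ≈⟨ ev′-hornerα _ (b ∷ v) ⟨
        ev′ (hornerα (lift (const (+ 1))) (b ∷ v))           ∎

    ev′-lower : ∀ es {as} → lower es ≡ just as → map ev′ es ≈P map ev as
    ev′-lower []             ≡.refl = []
    ev′-lower ((b ∷ v) ∷ es) eq with allZero v in zero? | lower es in rest
    ... | true | just as′ with ≡.refl ← eq =
      trans (+-congˡ (trans (*-congˡ (ev′-allZero v zero?)) (zeroʳ a))) (+-identityʳ _) ∷ ev′-lower es rest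

  -- By induction on n: x₁ is a root, so α ↦ x₁ evaluates
  -- 𝔸[α], and x₂,…,x_n split the quotient by X - x₁.
  charPoly-sound : ∀ {𝔸} (E : Evaluation 𝔸) n (rel : Vec (CompRing.Elem 𝔸) n) {k} (h : Vec ℤ k) {G}
                   (x y : Fin n → Carrier) →
                   prodR n x ≈P Evaluated.monic E rel →
                   (∀ j → y j ≈ evalℤ (x j) h) →
                   charPoly 𝔸 n rel h ≡ just G →
                   prodR n y ≈P map (Evaluation.ev E) G
  charPoly-sound E zero [] h x y _ _ ≡.refl =
    sym (trans (Evaluation.ev-const E (+ 1)) (+-identityʳ 1#)) ∷ []
  charPoly-sound {𝔸} E (suc n) (b ∷ bs) {k} h {G} x y split values eq =
    -- (X - y₁)·∏_{j>1} (X - yⱼ) is the value of (X - h(α))·G′ under α ↦ x₁, which descends to G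
    ≈P-trans (mulP-cong (lin-cong (trans (values fzero) (sym ev′-hα))) IH)
    (≈P-trans (mulP-cong (≈P-sym (linC-hom hα)) ≈P-refl)
    (≈P-trans (≈P-sym (mulC-hom (linC hα) G′)) (ev′-lower _ lowered)))
    where
    open Adjoin 𝔸 (b ∷ bs) using (Elem′; adjoined; quotient; hornerα; zeros; lower)
    open CompPoly adjoined using (mulC; linC)
    x₀ : Carrier
    x₀ = x fzero
    root : Evaluated.evalFrom E x₀ 1# (b ∷ bs) ≈ 0#
    root = begin
      Evaluated.evalFrom E x₀ 1# (b ∷ bs)   ≈⟨ Evaluated.evalP-monic E x₀ (b ∷ bs) ⟨
      evalP x₀ (Evaluated.monic E (b ∷ bs)) ≈⟨ evalP-cong x₀ (≈P-sym split) ⟩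
      evalP x₀ (prodR (suc n) x)            ≈⟨ prodR-root (suc n) x fzero ⟩
      0#                                    ∎
    open AdjoinEval E (b ∷ bs) x₀ root using (evaluation; ev′; ev′-hornerα; ev′-zeros; ev′-suffixValues; ev′-lower)
    open Evaluated evaluation using (linC-hom; mulC-hom)
    hℤ : Vec (CompRing.Elem 𝔸) k
    hℤ = Vec.map (CompRing.const 𝔸) h
    hα : Elem′
    hα = hornerα zeros hℤ
    ev′-hα : ev′ hα ≈ evalℤ x₀ h
    ev′-hα = trans (ev′-hornerα zeros hℤ)
                   (trans (Evaluated.evalFrom-cong E x₀ (ev′-zeros (suc n)) hℤ) (evalAt-const E x₀ h))
    descent : ∃ λ G′ → charPoly adjoined n quotient h ≡ just G′ × lower (mulC (linC hα) G′) ≡ just G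
    descent = >>=-just (charPoly adjoined n quotient h) _ eq
    G′ : List Elem′
    G′ = proj₁ descent
    lowered : lower (mulC (linC hα) G′) ≡ just G
    lowered = proj₂ (proj₂ descent)
    quotientSplit : prodR n (x ∘ fsuc) ≈P Evaluated.monic evaluation quotient
    quotientSplit = ≈P-trans (synthDiv x₀ (proj₂ (proj₂ (prodR-cons n (x ∘ fsuc)))) split) (ev′-suffixValues bs)
    IH : prodR n (y ∘ fsuc) ≈P map ev′ G′
    IH = charPoly-sound evaluation n quotient h (x ∘ fsuc) (y ∘ fsuc) quotientSplit (values ∘ fsuc)
                        (proj₁ (proj₂ descent))

  t-cong : ∀ i {u v} → u ≈ v → t i u ≈ t i v
  t-cong zero    e = +-congʳ (*-cong e e)
  t-cong (suc i) e = +-congʳ (*-cong (t-cong i e) (t-cong i e))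

  -- t_i = σ^(i+1), hence t_(i+m+1) = t_i ∘ t_m
  t-shift : ∀ i m u → t (i ℕ.+ suc m) u ≡ t i (t m u)
  t-shift zero    m u = ≡.refl
  t-shift (suc i) m u = ≡.cong (λ v → v * v - embedℕ 2) (t-shift i m u)

  -- σ is even, hence so is every t_i
  t-even : ∀ i u → t i (- u) ≈ t i u
  t-even zero    u = +-congʳ (begin
    - u * - u        ≈⟨ -‿distribˡ-* u (- u) ⟨
    - (u * - u)      ≈⟨ -‿cong (-‿distribʳ-* u u) ⟨
    - (- (u * u))    ≈⟨ -‿involutive _ ⟩
    u * u            ∎)
  t-even (suc i) u = +-congʳ (*-cong (t-even i u) (t-even i u))

  five-steps : ∀ k i → 5 ℕ.* suc k ℕ.+ i ≡ (5 ℕ.* k ℕ.+ i) ℕ.+ 5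
  five-steps = solve-∀

  t-periodic : ∀ {u} → t 4 u ≈ - u → ∀ k i → t (5 ℕ.* k ℕ.+ i) u ≈ t i u
  t-periodic σ⁵u zero    i = refl
  t-periodic {u} σ⁵u (suc k) i = begin
    t (5 ℕ.* suc k ℕ.+ i) u      ≡⟨ ≡.cong (λ j → t j u) (five-steps k i) ⟩
    t ((5 ℕ.* k ℕ.+ i) ℕ.+ 5) u  ≡⟨ t-shift (5 ℕ.* k ℕ.+ i) 4 u ⟩
    t (5 ℕ.* k ℕ.+ i) (t 4 u)    ≈⟨ t-cong (5 ℕ.* k ℕ.+ i) σ⁵u ⟩
    t (5 ℕ.* k ℕ.+ i) (- u)      ≈⟨ t-even (5 ℕ.* k ℕ.+ i) u ⟩
    t (5 ℕ.* k ℕ.+ i) u          ≈⟨ t-periodic σ⁵u k i ⟩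
    t i u                        ∎

  -- At a root u of V, evaluation ℤ[x]/(V) → R, x ↦ u, transports σ⁵(x) = -x
  -- and gives T_(5k+r)(u) = h_r(u).
  module RootOfV (u : Carrier) (root : Evaluated.evalFrom ℤ-evaluation u 1# Vlow ≈ 0#) where
    open AdjoinEval ℤ-evaluation Vlow u root using (evaluation; ev′-α)
    open Evaluation evaluation using (ev; ev-⊕; ev-⊝)
    open Evaluated evaluation using (ev-tC)
    open CompRing ℤ[x]/V using (_⊕_; ⊝_)
    open Iterates ℤ[x]/V using (tC)

    σ⁵-at-root : t 4 u ≈ - u
    σ⁵-at-root = begin
      t 4 u          ≈⟨ t-cong 4 ev′-α ⟨
      t 4 (ev xV)    ≈⟨ ev-tC 4 xV ⟨
      ev (tC 4 xV)   ≡⟨ ≡.cong ev σ⁵≡-id ⟩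
      ev (⊝ xV)      ≈⟨ ev-⊝ xV ⟩
      - ev xV        ≈⟨ -‿cong ev′-α ⟩
      - u            ∎

    T-at-root : ∀ k r → T (5 ℕ.* k ℕ.+ r) u ≈ evalℤ u (Tclass r)
    T-at-root k r = begin
      t (5 ℕ.* k ℕ.+ r) u - u    ≈⟨ +-congʳ (t-periodic σ⁵-at-root k r) ⟩
      t r u - u                  ≈⟨ +-cong (t-cong r (sym ev′-α)) (-‿cong (sym ev′-α)) ⟩
      t r (ev xV) - ev xV        ≈⟨ +-cong (ev-tC r xV) (ev-⊝ xV) ⟨
      ev (tC r xV) + ev (⊝ xV)   ≈⟨ ev-⊕ (tC r xV) (⊝ xV) ⟨
      ev (Tclass r)              ∎

  module RootsOfV (x : Fin 5 → Carrier) (V-split : prod5 x ≈P fromℤPoly Vpoly) where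
    open Evaluated ℤ-evaluation using (monic; evalFrom; evalP-monic)

    -- the hypothesis, with the leading coefficient of V read as 1#
    V-split′ : prodR 5 x ≈P monic Vlow
    V-split′ = ≈P-trans V-split (refl ∷ refl ∷ refl ∷ refl ∷ refl ∷ +-identityʳ 1# ∷ [])

    root : ∀ j → evalFrom (x j) 1# Vlow ≈ 0#
    root j = begin
      evalFrom (x j) 1# Vlow      ≈⟨ evalP-monic (x j) Vlow ⟨
      evalP (x j) (monic Vlow)    ≈⟨ evalP-cong (x j) (≈P-sym V-split′) ⟩
      evalP (x j) (prodR 5 x)     ≈⟨ prodR-root 5 x j ⟩
      0#                          ∎

    T-poly : ∀ r {P} → charPoly ℤ-comp 5 Vlow (Tclass r) ≡ just P →
             ∀ k → TiPoly (5 ℕ.* k ℕ.+ r) x ≈P fromℤPoly P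
    T-poly r eq k = charPoly-sound ℤ-evaluation 5 Vlow (Tclass r) x (λ j → T (5 ℕ.* k ℕ.+ r) (x j))
                                   V-split′ (λ j → RootOfV.T-at-root (x j) (root j) k r) eq

    periodicity : ∀ k →
        TiPoly (5 ℕ.* k) x ≈P fromℤPoly Apoly
      × TiPoly (5 ℕ.* k ℕ.+ 1) x ≈P fromℤPoly Gpoly
      × TiPoly (5 ℕ.* k ℕ.+ 2) x ≈P fromℤPoly Gpoly
      × TiPoly (5 ℕ.* k ℕ.+ 3) x ≈P fromℤPoly Apoly
      × TiPoly (5 ℕ.* k ℕ.+ 4) x ≈P fromℤPoly Bpoly
    periodicity k =
        ≡.subst (λ i → TiPoly i x ≈P fromℤPoly Apoly) (ℕP.+-identityʳ (5 ℕ.* k)) (T-poly 0 charPoly-T₀ k)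
      , T-poly 1 charPoly-T₁ k , T-poly 2 charPoly-T₂ k , T-poly 3 charPoly-T₃ k , T-poly 4 charPoly-T₄ k

open import Data.Nat using (_*_; _+_)

mainTheorem6 :
    ∀ {c ℓ : Level} (R : CommutativeRing c ℓ) →
    (∀ (x : Fin 5 → CommutativeRing.Carrier R) →
      RingPoly._≈P_ R (RingPoly.prod5 R x) (RingPoly.fromℤPoly R Vpoly) →
      ∀ (k : ℕ) →
        RingPoly._≈P_ R (RingPoly.TiPoly R (5 * k) x) (RingPoly.fromℤPoly R Apoly)
        × RingPoly._≈P_ R (RingPoly.TiPoly R (5 * k + 1) x) (RingPoly.fromℤPoly R Gpoly)
        × RingPoly._≈P_ R (RingPoly.TiPoly R (5 * k + 2) x) (RingPoly.fromℤPoly R Gpoly)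
        × RingPoly._≈P_ R (RingPoly.TiPoly R (5 * k + 3) x) (RingPoly.fromℤPoly R Apoly)
        × RingPoly._≈P_ R (RingPoly.TiPoly R (5 * k + 4) x) (RingPoly.fromℤPoly R Bpoly))
    × discMonic Apoly ≡ (+ 11) ℤ.^ 4
    × discMonic Bpoly ≡ (+ 11) ℤ.^ 4 ℤ.* (+ 2) ℤ.^ 20
mainTheorem6 R = (λ x V-split → OverRing.RootsOfV.periodicity R x V-split) , disc-A , disc-B
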